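{- Let $P:\mathcal{C}^{op}\to\mathbf{InfSL}$ be an elementary doctrine with weak comprehensions and comprehensive weak equalizers. Then the functor $J:\mathcal{C}\to\mathcal{Q}_P$, $A\mapsto(A,\delta_A)$, $f\mapsto[f]$, is faithful.
   Context: A primary doctrine is a functor $P:\mathcal{C}^{op}\to\mathbf{InfSL}$ where $\mathcal{C}$ has finite products, each $P(A)$ is a poset with finite meets ($\wedge$, top $\top_A$) and each $P_f$ preserves them. Write $f\times g=\langle f\circ pr_1,g\circ pr_2\rangle$, $\Delta_A=\langle id_A,id_A\rangle$. $P$ is elementary if each $P_{id_C\times\Delta_A}$ has a left adjoint $\exists_{id_C\times\Delta_A}$ satisfying Frobenius reciprocity; $\delta_A=\exists_{\Delta_A}(\top_A)$. A weak comprehension of $\alpha\in P(A)$ is $\{\alpha\}:X\to A$ with $\top_X\le P_{\{\alpha\}}(\alpha)$ through which every $g:Y\to A$ with $\top_Y\le P_g(\alpha)$ factors (not necessarily uniquely); it is stable if for every $f:A'\to A$, $P_f(\alpha)$ has a weak comprehension $\{P_f(\alpha)\}:X'\to A'$ and some $f':X'\to X$ makes the square with $\{\alpha\}$ and $f$ a weak pullback. $P$ has comprehensive weak equalizers if for every object $A$, $\Delta_A$ is a stable weak comprehension of $\delta_A$. $\mathcal{Q}_P$ has objects $(A,\rho)$ with $\rho\in P(A\times A)$ a $P$-equivalence relation (reflexive $\delta_A\le\rho$, symmetric, transitive); arrows $(A,\rho)\to(B,\sigma)$ are classes $[f]$ of $f:A\to B$ with $\rho\le P_{f\times f}(\sigma)$,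 modulo $f\sim g$ iff $\rho\le P_{f\times g}(\sigma)$. -}

module Defs where

open import Level using (Level; _⊔_) renaming (suc to lsuc)
open import Relation.Binary.PropositionalEquality using (_≡_)
open import Data.Product using (Σ; _×_; _,_)

record Category (o h : Level) : Set (lsuc (o ⊔ h)) where
  infixr 9 _∘_
  field
    Obj  : Set o
    Hom  : Obj → Obj → Set h
    id   : ∀ {A} → Hom A A
    _∘_  : ∀ {A B C} → Hom B C → Hom A B → Hom A C
    identityˡ : ∀ {A B} (f : Hom A B) → id ∘ f ≡ f
    identityʳ : ∀ {A B} (f : Hom A B) → f ∘ id ≡ f
    assoc     : ∀ {A B C D} (f : Hom A B) (g : Hom B C) (k : Hom C D) →
                (k ∘ g) ∘ f ≡ k ∘ (g ∘ f)

module _ {o h : Level} (𝒞 : Category o h) where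
  open Category 𝒞

  record FinProducts : Set (o ⊔ h) where
    infixr 7 _⊗_
    field
      𝟙        : Obj
      !        : ∀ {A} → Hom A 𝟙
      !-unique : ∀ {A} (f : Hom A 𝟙) → f ≡ !
      _⊗_      : Obj → Obj → Obj
      π₁       : ∀ {A B} → Hom (A ⊗ B) A
      π₂       : ∀ {A B} → Hom (A ⊗ B) B
      ⟨_,_⟩    : ∀ {X A B} → Hom X A → Hom X B → Hom X (A ⊗ B)
      π₁-β     : ∀ {X A B} (f : Hom X A) (g : Hom X B) → π₁ ∘ ⟨ f , g ⟩ ≡ f
      π₂-β     : ∀ {X A B} (f : Hom X A) (g : Hom X B) → π₂ ∘ ⟨ f , g ⟩ ≡ g
      ⟨⟩-unique : ∀ {X A B} (f : Hom X A) (g : Hom X B) (k : Hom X (A ⊗ B)) →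
                  π₁ ∘ k ≡ f → π₂ ∘ k ≡ g → k ≡ ⟨ f , g ⟩

    _×₁_ : ∀ {A B A' B'} → Hom A A' → Hom B B' → Hom (A ⊗ B) (A' ⊗ B')
    f ×₁ g = ⟨ f ∘ π₁ , g ∘ π₂ ⟩

    Δ : (A : Obj) → Hom A (A ⊗ A)
    Δ A = ⟨ id , id ⟩

  module _ (FP : FinProducts) where
    open FinProducts FP

    -- Primary doctrine P : 𝒞^op → InfSL (with propositional equality on
    -- the posets P(A), so antisymmetry and functoriality are stated with ≡).
    record PrimaryDoctrine (p r : Level) : Set (o ⊔ h ⊔ lsuc (p ⊔ r)) where
      infix 4 _≤_
      infixr 6 _∧_
      field
        P        : Obj → Set p
        _≤_      : ∀ {A} → P A → P A → Set r
        ≤-refl   : ∀ {A} (α : P A) → α ≤ α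
        ≤-trans  : ∀ {A} {α β γ : P A} → α ≤ β → β ≤ γ → α ≤ γ
        ≤-antisym : ∀ {A} {α β : P A} → α ≤ β → β ≤ α → α ≡ β
        ⊤        : ∀ {A} → P A
        ⊤-max    : ∀ {A} (α : P A) → α ≤ ⊤
        _∧_      : ∀ {A} → P A → P A → P A
        ∧-lb₁    : ∀ {A} (α β : P A) → α ∧ β ≤ α
        ∧-lb₂    : ∀ {A} (α β : P A) → α ∧ β ≤ β
        ∧-glb    : ∀ {A} {α β γ : P A} → γ ≤ α → γ ≤ β → γ ≤ α ∧ β
        reindex  : ∀ {A B} → Hom A B → P B → P A
        reindex-∧ : ∀ {A B} (f : Hom A B) (α β : P B) →
                    reindex f (α ∧ β) ≡ reindex f α ∧ reindex f β
        reindex-⊤ : ∀ {A B} (f : Hom A B) → reindex f ⊤ ≡ ⊤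
        reindex-id : ∀ {A} (α : P A) → reindex id α ≡ α
        reindex-∘  : ∀ {A B C} (f : Hom A B) (g : Hom B C) (α : P C) →
                     reindex (g ∘ f) α ≡ reindex f (reindex g α)

    -- Elementary doctrine: left adjoints ∃_{id_C × Δ_A} ⊣ P_{id_C × Δ_A}
    -- satisfying Frobenius reciprocity.
    record ElementaryDoctrine (p r : Level) : Set (o ⊔ h ⊔ lsuc (p ⊔ r)) where
      field
        primary : PrimaryDoctrine p r
      open PrimaryDoctrine primary
      field
        ∃Δ : ∀ (C A : Obj) → P (C ⊗ A) → P (C ⊗ (A ⊗ A))
        ∃Δ-unit   : ∀ {C A} (α : P (C ⊗ A)) (β : P (C ⊗ (A ⊗ A))) →
                    ∃Δ C A α ≤ β → α ≤ reindex (id ×₁ Δ A) β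
        ∃Δ-counit : ∀ {C A} (α : P (C ⊗ A)) (β : P (C ⊗ (A ⊗ A))) →
                    α ≤ reindex (id ×₁ Δ A) β → ∃Δ C A α ≤ β
        frobenius : ∀ {C A} (α : P (C ⊗ A)) (β : P (C ⊗ (A ⊗ A))) →
                    ∃Δ C A (α ∧ reindex (id ×₁ Δ A) β) ≡ ∃Δ C A α ∧ β

      -- δ_A = ∃_{Δ_A}(⊤_A), where ∃_{Δ_A} is obtained from ∃_{id_𝟙 × Δ_A}
      -- via the isomorphisms A ≅ 𝟙 × A, A × A ≅ 𝟙 × (A × A):
      -- ∃_{Δ_A}(α) = P_{⟨!,id⟩}(∃_{id_𝟙×Δ_A}(P_{π₂}(α))).
      ∃Δ₀ : (A : Obj) → P A → P (A ⊗ A)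
      ∃Δ₀ A α = reindex ⟨ ! , id ⟩ (∃Δ 𝟙 A (reindex π₂ α))

      δ : (A : Obj) → P (A ⊗ A)
      δ A = ∃Δ₀ A ⊤

      record IsWeakComprehension {A X : Obj} (α : P A) (c : Hom X A)
             : Set (o ⊔ h ⊔ r) where
        field
          holds   : ⊤ ≤ reindex c α
          factors : ∀ {Y} (g : Hom Y A) → ⊤ ≤ reindex g α →
                    Σ (Hom Y X) (λ k → c ∘ k ≡ g)

      IsWeakPullback : ∀ {X A X' A'} (c : Hom X A) (f : Hom A' A)
                       (c' : Hom X' A') (f' : Hom X' X) → Set (o ⊔ h)
      IsWeakPullback {X} {A} {X'} {A'} c f c' f' =
        (c ∘ f' ≡ f ∘ c') ×
        (∀ {Z} (u : Hom Z X) (v : Hom Z A') → c ∘ u ≡ f ∘ v →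
           Σ (Hom Z X') (λ w → (f' ∘ w ≡ u) × (c' ∘ w ≡ v)))

      IsStableWeakComprehension : ∀ {A X : Obj} (α : P A) (c : Hom X A)
                                  → Set (o ⊔ h ⊔ r)
      IsStableWeakComprehension {A} {X} α c =
        IsWeakComprehension α c ×
        (∀ {A'} (f : Hom A' A) →
           Σ Obj λ X' → Σ (Hom X' A') λ c' →
             IsWeakComprehension (reindex f α) c' ×
             Σ (Hom X' X) λ f' → IsWeakPullback c f c' f')

      HasWeakComprehensions : Set (o ⊔ h ⊔ p ⊔ r)
      HasWeakComprehensions =
        ∀ {A} (α : P A) → Σ Obj λ X → Σ (Hom X A) λ c → IsWeakComprehension α c

      HasComprehensiveWeakEqualizers : Set (o ⊔ h ⊔ r)
      HasComprehensiveWeakEqualizers =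
        ∀ (A : Obj) → IsStableWeakComprehension (δ A) (Δ A)

      -- Arrows of Q_P between (A,ρ) and (B,σ) are classes of f with
      -- ρ ≤ P_{f×f}(σ), where f ∼ g iff ρ ≤ P_{f×g}(σ).
      QArrowEq : ∀ {A B} (ρ : P (A ⊗ A)) (σ : P (B ⊗ B)) (f g : Hom A B) → Set r
      QArrowEq ρ σ f g = ρ ≤ reindex (f ×₁ g) σ

      JFaithful : Set (o ⊔ h ⊔ r)
      JFaithful = ∀ {A B} (f g : Hom A B) → QArrowEq (δ A) (δ B) f g → f ≡ g

-- If [f] = [g] as arrows (A, δ_A) → (B, δ_B), then reflexivity of δ_A (the diagonal
-- Δ_A lies in δ_A) gives ⊤ ≤ P_{⟨f,g⟩}(δ_B). Since Δ_B is a weak comprehension of δ_B,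
-- ⟨f,g⟩ factors as Δ_B ∘ k, and projecting gives f = k = g.
module Submission where

open import Level using (Level)
open import Relation.Binary.PropositionalEquality using (_≡_; sym; trans; cong; cong₂; subst; module ≡-Reasoning)
open import Data.Product using (_,_; proj₁)

open import Defs

module _ {o h : Level} {𝒞 : Category o h} (FP : FinProducts 𝒞) where
  open Category 𝒞
  open FinProducts FP
  open ≡-Reasoning

  ×₁∘⟨⟩ : ∀ {X A B A' B'} (f : Hom A A') (g : Hom B B') (u : Hom X A) (v : Hom X B) →
          (f ×₁ g) ∘ ⟨ u , v ⟩ ≡ ⟨ f ∘ u , g ∘ v ⟩
  ×₁∘⟨⟩ f g u v = ⟨⟩-unique (f ∘ u) (g ∘ v) _
    (begin
      π₁ ∘ (f ×₁ g) ∘ ⟨ u , v ⟩   ≡⟨ sym (assoc _ _ _) ⟩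
      (π₁ ∘ (f ×₁ g)) ∘ ⟨ u , v ⟩ ≡⟨ cong (_∘ ⟨ u , v ⟩) (π₁-β _ _) ⟩
      (f ∘ π₁) ∘ ⟨ u , v ⟩        ≡⟨ assoc _ _ _ ⟩
      f ∘ π₁ ∘ ⟨ u , v ⟩          ≡⟨ cong (f ∘_) (π₁-β u v) ⟩
      f ∘ u                       ∎)
    (begin
      π₂ ∘ (f ×₁ g) ∘ ⟨ u , v ⟩   ≡⟨ sym (assoc _ _ _) ⟩
      (π₂ ∘ (f ×₁ g)) ∘ ⟨ u , v ⟩ ≡⟨ cong (_∘ ⟨ u , v ⟩) (π₂-β _ _) ⟩
      (g ∘ π₂) ∘ ⟨ u , v ⟩        ≡⟨ assoc _ _ _ ⟩
      g ∘ π₂ ∘ ⟨ u , v ⟩          ≡⟨ cong (g ∘_) (π₂-β u v) ⟩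
      g ∘ v                       ∎)

  ×₁∘Δ : ∀ {A B} (f g : Hom A B) → (f ×₁ g) ∘ Δ A ≡ ⟨ f , g ⟩
  ×₁∘Δ f g = trans (×₁∘⟨⟩ f g id id) (cong₂ ⟨_,_⟩ (identityʳ f) (identityʳ g))

  π₁∘Δ : ∀ {B X} (k : Hom X B) → π₁ ∘ Δ B ∘ k ≡ k
  π₁∘Δ k = trans (sym (assoc _ _ _)) (trans (cong (_∘ k) (π₁-β id id)) (identityˡ k))

  π₂∘Δ : ∀ {B X} (k : Hom X B) → π₂ ∘ Δ B ∘ k ≡ k
  π₂∘Δ k = trans (sym (assoc _ _ _)) (trans (cong (_∘ k) (π₂-β id id)) (identityˡ k))

  factors-through-Δ⇒≡ : ∀ {X B} {f g : Hom X B} (k : Hom X B) →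
                        Δ B ∘ k ≡ ⟨ f , g ⟩ → f ≡ g
  factors-through-Δ⇒≡ {B = B} {f} {g} k Δk≡⟨f,g⟩ = begin
    f                   ≡⟨ sym (π₁-β f g) ⟩
    π₁ ∘ ⟨ f , g ⟩      ≡⟨ cong (π₁ ∘_) (sym Δk≡⟨f,g⟩) ⟩
    π₁ ∘ Δ B ∘ k        ≡⟨ π₁∘Δ k ⟩
    k                   ≡⟨ sym (π₂∘Δ k) ⟩
    π₂ ∘ Δ B ∘ k        ≡⟨ cong (π₂ ∘_) Δk≡⟨f,g⟩ ⟩
    π₂ ∘ ⟨ f , g ⟩      ≡⟨ π₂-β f g ⟩
    g                   ∎

  module _ {p r : Level} (D : PrimaryDoctrine 𝒞 FP p r) where
    open PrimaryDoctrine D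

    reindex-mono : ∀ {X Y} (u : Hom X Y) {α β : P Y} → α ≤ β → reindex u α ≤ reindex u β
    reindex-mono u {α} {β} α≤β =
      subst (λ γ → reindex u γ ≤ reindex u β) (sym α∧β≡α)
        (subst (_≤ reindex u β) (sym (reindex-∧ u α β)) (∧-lb₂ _ _))
      where
      α∧β≡α : α ≡ α ∧ β
      α∧β≡α = ≤-antisym (∧-glb (≤-refl α) α≤β) (∧-lb₁ α β)

    reindex-≤-×₁ : ∀ {A B} {ρ : P (A ⊗ A)} {σ : P (B ⊗ B)} (f g : Hom A B) →
                   ⊤ ≤ reindex (Δ A) ρ → ρ ≤ reindex (f ×₁ g) σ →
                   ⊤ ≤ reindex ⟨ f , g ⟩ σ
    reindex-≤-×₁ {A} {σ = σ} f g ⊤≤ρΔ ρ≤σf×g =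
      subst (⊤ ≤_) reindex-Δ (≤-trans ⊤≤ρΔ (reindex-mono (Δ A) ρ≤σf×g))
      where
      reindex-Δ : reindex (Δ A) (reindex (f ×₁ g) σ) ≡ reindex ⟨ f , g ⟩ σ
      reindex-Δ = trans (sym (reindex-∘ (Δ A) (f ×₁ g) σ)) (cong (λ u → reindex u σ) (×₁∘Δ f g))

  module _ {p r : Level} (D : ElementaryDoctrine 𝒞 FP p r) where
    open ElementaryDoctrine D
    open PrimaryDoctrine primary

    weakComprehension-δ⇒≡ : ∀ {X B} {f g : Hom X B} →
                            IsWeakComprehension (δ B) (Δ B) →
                            ⊤ ≤ reindex ⟨ f , g ⟩ (δ B) → f ≡ g
    weakComprehension-δ⇒≡ {f = f} {g} Δ-comprehends ⊤≤δ⟨f,g⟩ =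
      let k , Δk≡⟨f,g⟩ = IsWeakComprehension.factors Δ-comprehends ⟨ f , g ⟩ ⊤≤δ⟨f,g⟩
      in factors-through-Δ⇒≡ k Δk≡⟨f,g⟩

lemma5p7 : ∀ {o h p r} (𝒞 : Category o h) (FP : FinProducts 𝒞)
    (D : ElementaryDoctrine 𝒞 FP p r) →
    ElementaryDoctrine.HasWeakComprehensions D →
    ElementaryDoctrine.HasComprehensiveWeakEqualizers D →
    ElementaryDoctrine.JFaithful D
lemma5p7 𝒞 FP D _ cwe {A} {B} f g δA≤δB[f×g] =
  weakComprehension-δ⇒≡ FP D Δ-comprehends-δ
    (reindex-≤-×₁ FP primary f g (IsWeakComprehension.holds (proj₁ (cwe A))) δA≤δB[f×g])
  where
  open ElementaryDoctrine D
  Δ-comprehends-δ : IsWeakComprehension (δ B) (FinProducts.Δ FP B)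
  Δ-comprehends-δ = proj₁ (cwe B)
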